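{- Let $(M,\eta,\mu)$ and $(\hat M,\hat\eta,\hat\mu)$ be monads on $\mathbf{Sets}$ and $\sigma\colon M\Rightarrow\hat M$ a monad map all of whose components are injective. Let $t\colon X\to(MX)^A$ and $\hat t=\sigma_X^A\circ t\colon X\to(\hat MX)^A$. Then the trace equivalences of $t$ and of $\hat t$ coincide as relations on $X$.
   Context: A monad map $\sigma\colon M\Rightarrow\hat M$ is a natural transformation with $\sigma\circ\eta=\hat\eta$ and $\sigma\circ\mu=\hat\mu\circ\hat M\sigma\circ\sigma_M$. Trace equivalence for $t\colon X\to(MX)^A$ (a system with $M$-effects): let $1=\{\bullet\}$, $O=M1$, $o=\eta_1\circ !\colon X\to M1$ (where $!\colon X\to1$), and consider the determinisation $\langle o^\sharp,t^\sharp\rangle\colon MX\to M1\times(MX)^A$ of $\langle o,t\rangle$ with respect to the free algebra $\mu_1\colon MM1\to M1$: $o^\sharp=\mu_1\circ Mo$ and $t^\sharp(m)(\ell)=\mu_X(M(\mathrm{ev}_\ell\circ t)(m))$ with $\mathrm{ev}_\ell(g)=g(\ell)$. Define $[\![\cdot]\!]\colon MX\to(M1)^{A^*}$ by $[\![m]\!](\varepsilon)=o^\sharp(m)$, $[\![m]\!](\ell w)=[\![t^\sharp(m)(\ell)]\!](w)$. Two states $x,y\in X$ are trace equivalent iff $[\![\eta_X(x)]\!]=[\![\eta_X(y)]\!]$. -}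

module Defs where

open import Data.Unit using (⊤; tt)
open import Data.List using (List; []; _∷_)
open import Function using (_∘_; id)
open import Relation.Binary.PropositionalEquality using (_≡_)

record Monad : Set₁ where
  field
    M     : Set → Set
    fmap  : ∀ {X Y : Set} → (X → Y) → M X → M Y
    η     : ∀ {X : Set} → X → M X
    μ     : ∀ {X : Set} → M (M X) → M X
    fmap-cong : ∀ {X Y : Set} {f g : X → Y} → (∀ x → f x ≡ g x) → ∀ m → fmap f m ≡ fmap g m
    fmap-id   : ∀ {X : Set} (m : M X) → fmap id m ≡ m
    fmap-∘    : ∀ {X Y Z : Set} (g : Y → Z) (f : X → Y) (m : M X) →
                fmap (g ∘ f) m ≡ fmap g (fmap f m)
    η-nat : ∀ {X Y : Set} (f : X → Y) (x : X) → fmap f (η x) ≡ η (f x)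
    μ-nat : ∀ {X Y : Set} (f : X → Y) (m : M (M X)) → fmap f (μ m) ≡ μ (fmap (fmap f) m)
    μ-η     : ∀ {X : Set} (m : M X) → μ (η m) ≡ m
    μ-fmapη : ∀ {X : Set} (m : M X) → μ (fmap η m) ≡ m
    μ-assoc : ∀ {X : Set} (m : M (M (M X))) → μ (μ m) ≡ μ (fmap μ m)

open Monad public

record MonadMap (T T̂ : Monad) : Set₁ where
  field
    σ     : ∀ {X : Set} → M T X → M T̂ X
    σ-nat : ∀ {X Y : Set} (f : X → Y) (m : M T X) → σ (fmap T f m) ≡ fmap T̂ f (σ m)
    σ-η   : ∀ {X : Set} (x : X) → σ (η T x) ≡ η T̂ x
    σ-μ   : ∀ {X : Set} (m : M T (M T X)) → σ (μ T m) ≡ μ T̂ (fmap T̂ σ (σ m))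

open MonadMap public

module _ (T : Monad) {X A : Set} (t : X → A → M T X) where

  o : X → M T ⊤
  o _ = η T tt

  -- determinisation w.r.t. the free algebra μ₁ : M M 1 → M 1
  o♯ : M T X → M T ⊤
  o♯ m = μ T (fmap T o m)

  t♯ : M T X → A → M T X
  t♯ m ℓ = μ T (fmap T (λ x → t x ℓ) m)

  ⟦_⟧ : M T X → List A → M T ⊤
  ⟦ m ⟧ []      = o♯ m
  ⟦ m ⟧ (ℓ ∷ w) = ⟦ t♯ m ℓ ⟧ w

  TraceEq : X → X → Set
  TraceEq x y = ∀ (w : List A) → ⟦ η T x ⟧ w ≡ ⟦ η T y ⟧ w

-- A monad map commutes with Kleisli extension, so σ carries the determinisation
-- of t to that of t̂ = σ ∘ t and hence σ ∘ ⟦ m ⟧ = ⟦ σ m ⟧̂. Since σ(η x) = η̂ x,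
-- the traces of x under t̂ are the σ-images of its traces under t, and an
-- injective σ neither creates nor destroys equalities between them.
module Submission where

open import Defs
open import Function using (_⇔_; mk⇔; _∘_; Equivalence)
open import Function.Definitions using (Injective)
open import Relation.Binary.PropositionalEquality
open import Data.Unit using (tt)
open import Data.List using (List; []; _∷_)

module _ {T T̂ : Monad} (s : MonadMap T T̂) where

  σ-bind : ∀ {X Y : Set} (f : X → M T Y) (m : M T X) →
           σ s (μ T (fmap T f m)) ≡ μ T̂ (fmap T̂ (σ s ∘ f) (σ s m))
  σ-bind f m = begin
      σ s (μ T (fmap T f m))                 ≡⟨ σ-μ s _ ⟩
      μ T̂ (fmap T̂ (σ s) (σ s (fmap T f m)))  ≡⟨ cong (μ T̂ ∘ fmap T̂ (σ s)) (σ-nat s f m) ⟩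
      μ T̂ (fmap T̂ (σ s) (fmap T̂ f (σ s m)))  ≡⟨ cong (μ T̂) (fmap-∘ T̂ (σ s) f (σ s m)) ⟨
      μ T̂ (fmap T̂ (σ s ∘ f) (σ s m))         ∎
    where open ≡-Reasoning

  module _ {X A : Set} (t : X → A → M T X) where

    t̂ : X → A → M T̂ X
    t̂ z ℓ = σ s (t z ℓ)

    σ-o♯ : ∀ m → σ s (o♯ T t m) ≡ o♯ T̂ t̂ (σ s m)
    σ-o♯ m = trans (σ-bind (o T t) m) (cong (μ T̂) (fmap-cong T̂ (λ _ → σ-η s tt) (σ s m)))

    σ-t♯ : ∀ m ℓ → σ s (t♯ T t m ℓ) ≡ t♯ T̂ t̂ (σ s m) ℓ
    σ-t♯ m ℓ = σ-bind (λ x → t x ℓ) m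

    σ-⟦⟧ : ∀ m w → σ s (⟦_⟧ T t m w) ≡ ⟦_⟧ T̂ t̂ (σ s m) w
    σ-⟦⟧ m []      = σ-o♯ m
    σ-⟦⟧ m (ℓ ∷ w) = trans (σ-⟦⟧ (t♯ T t m ℓ) w) (cong (λ n → ⟦_⟧ T̂ t̂ n w) (σ-t♯ m ℓ))

    σ-trace : ∀ x w → σ s (⟦_⟧ T t (η T x) w) ≡ ⟦_⟧ T̂ t̂ (η T̂ x) w
    σ-trace x w = trans (σ-⟦⟧ (η T x) w) (cong (λ n → ⟦_⟧ T̂ t̂ n w) (σ-η s x))

≡⇔≡-through-injective : {B C D : Set} {f : B → C} {g : B → D} (h : C → D) →
                        Injective _≡_ _≡_ h → h ∘ f ≗ g →
                        ∀ b c → f b ≡ f c ⇔ g b ≡ g c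
≡⇔≡-through-injective h inj hf≡g b c = mk⇔
  (λ e → trans (sym (hf≡g b)) (trans (cong h e) (hf≡g c)))
  (λ e → inj (trans (hf≡g b) (trans e (sym (hf≡g c)))))

corollary6p15 : (T T̂ : Monad) (s : MonadMap T T̂) →
    (∀ {Z : Set} → Injective _≡_ _≡_ (σ s {Z})) →
    {X A : Set} (t : X → A → M T X) →
    ∀ (x y : X) → TraceEq T t x y ⇔ TraceEq T̂ (λ z ℓ → σ s (t z ℓ)) x y
corollary6p15 T T̂ s inj t x y = mk⇔
  (λ e w → Equivalence.to   (pointwise w) (e w))
  (λ e w → Equivalence.from (pointwise w) (e w))
  where
  pointwise : ∀ w → ⟦_⟧ T t (η T x) w ≡ ⟦_⟧ T t (η T y) w
                  ⇔ ⟦_⟧ T̂ (t̂ s t) (η T̂ x) w ≡ ⟦_⟧ T̂ (t̂ s t) (η T̂ y) w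
  pointwise w = ≡⇔≡-through-injective (σ s) inj (λ z → σ-trace s t z w) x y
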